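{- Let $S$ be a forwarding network and, for agents $a,b$, let $\mathcal{J}_{a\leftarrow b}A:=\bigwedge\{\mathcal{I}_{a\leftarrow\gamma\leftarrow b}A \mid \gamma\in\mathbb{A}^*,\ (a,\gamma,b)\in S\}$. Then for all agents $a,b$: (i) $\mathcal{J}_{a\leftarrow b}$ satisfies axiom K (i.e. $\vdash\mathcal{J}_{a\leftarrow b}A\Rightarrow\mathcal{J}_{a\leftarrow b}(A\Rightarrow B)\Rightarrow\mathcal{J}_{a\leftarrow b}B$ for all $A,B$) and necessitation (if $\vdash A$ then $\vdash\mathcal{J}_{a\leftarrow b}A$); (ii) $\vdash\mathcal{J}_{a\leftarrow b}A\Rightarrow\mathcal{B}_a\mathcal{J}_{a\leftarrow b}A$; (iii) $\vdash\mathcal{J}_{a\leftarrow b}A\Rightarrow\mathcal{J}_{a\leftarrow b}\mathcal{B}_bA$.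
   Context: Setting: finite set of agents $\mathbb{A}$ with preorder $\sqsubseteq$; modalities $\mathcal{B}_a$, $\mathcal{I}_{a\leftarrow b}$ and $\Box$; formulas $A,B::=\top\mid\bot\mid t\mid\mathcal{M}A\mid A\Rightarrow B\mid A\wedge B\mid A\vee B$ (finite conjunctions allowed, empty conjunction $=\top$). $\vdash$ is provability in intuitionistic propositional logic with K and necessitation for every modality, plus schemes $\mathcal{B}_aA\Rightarrow\mathcal{B}_a\mathcal{B}_aA$, $\mathcal{I}_{a\leftarrow b}A\Rightarrow\mathcal{B}_a\mathcal{I}_{a\leftarrow b}A$, $\mathcal{I}_{a\leftarrow b}A\Rightarrow\mathcal{I}_{a\leftarrow b}\mathcal{B}_bA$, for $a\sqsubseteq b$: $\mathcal{B}_aA\Rightarrow\mathcal{B}_bA$, $\mathcal{I}_{a\leftarrow c}A\Rightarrow\mathcal{I}_{b\leftarrow c}A$, $\mathcal{I}_{c\leftarrow a}A\Rightarrow\mathcal{I}_{c\leftarrow b}A$; $\Box A\Rightarrow\mathcal{M}\Box A$; $\Box A\Rightarrow A$. Notation $\mathcal{I}_{x_1\leftarrow\cdots\leftarrow x_k}:=\mathcal{I}_{x_1\leftarrow x_2}\cdots\mathcal{I}_{x_{k-1}\leftarrow x_k}$. A forwarding network is a set $S\subseteq\mathbb{A}^*$ of non-empty lists of pairwise distinct agents such that (1) $(a,\beta,c)\in S$ implies $(\beta,c)\in S$ and $(a,\beta)\in S$; (2) $(\alpha,a,\beta,b,\gamma)\in S$ and $(a,\beta',b)\in S$ imply $(\alpha,a,\beta',b,\gamma)\in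 S$ (lists possibly empty, commas denote concatenation). -}

module Defs where

open import Data.Nat using (ℕ)
open import Data.Fin using (Fin; _≟_)
open import Data.Bool using (Bool; true; false; _∧_)
open import Data.List using (List; []; _∷_; _++_; [_]; map; filterᵇ)
open import Data.List.Membership.Propositional using (_∈_)
open import Data.List.Relation.Unary.Unique.Propositional using (Unique)
open import Data.Product using (_×_)
open import Relation.Nullary.Decidable using (⌊_⌋)
open import Data.Empty using (⊥)
open import Data.Unit using (⊤)

data Modality (n : ℕ) : Set where
  𝓑 : Fin n → Modality n
  𝓘 : Fin n → Fin n → Modality n   -- 𝓘 a b  is  I_{a←b}
  □ : Modality n

infixr 5 _⇒_
infixr 6 _∧′_ _∨′_

data Form (n : ℕ) : Set where
  ⊤′ ⊥′ : Form n
  atom  : ℕ → Form n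
  mod   : Modality n → Form n → Form n
  _⇒_   : Form n → Form n → Form n
  _∧′_  : Form n → Form n → Form n
  _∨′_  : Form n → Form n → Form n

⋀ : ∀ {n} → List (Form n) → Form n
⋀ []       = ⊤′
⋀ (A ∷ As) = A ∧′ ⋀ As

data ⊢ {n : ℕ} (_⊑_ : Fin n → Fin n → Set) : Form n → Set where
  ax-K   : ∀ {A B} → ⊢ _⊑_ (A ⇒ B ⇒ A)
  ax-S   : ∀ {A B C} → ⊢ _⊑_ ((A ⇒ B ⇒ C) ⇒ (A ⇒ B) ⇒ A ⇒ C)
  ax-∧I  : ∀ {A B} → ⊢ _⊑_ (A ⇒ B ⇒ A ∧′ B)
  ax-∧E₁ : ∀ {A B} → ⊢ _⊑_ (A ∧′ B ⇒ A)
  ax-∧E₂ : ∀ {A B} → ⊢ _⊑_ (A ∧′ B ⇒ B)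
  ax-∨I₁ : ∀ {A B} → ⊢ _⊑_ (A ⇒ A ∨′ B)
  ax-∨I₂ : ∀ {A B} → ⊢ _⊑_ (B ⇒ A ∨′ B)
  ax-∨E  : ∀ {A B C} → ⊢ _⊑_ ((A ⇒ C) ⇒ (B ⇒ C) ⇒ A ∨′ B ⇒ C)
  ax-⊥E  : ∀ {A} → ⊢ _⊑_ (⊥′ ⇒ A)
  ax-⊤I  : ⊢ _⊑_ ⊤′
  mp     : ∀ {A B} → ⊢ _⊑_ (A ⇒ B) → ⊢ _⊑_ A → ⊢ _⊑_ B
  ax-Kₘ  : ∀ {M A B} → ⊢ _⊑_ (mod M (A ⇒ B) ⇒ mod M A ⇒ mod M B)
  nec    : ∀ {M A} → ⊢ _⊑_ A → ⊢ _⊑_ (mod M A)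
  ax-B4     : ∀ {a A} → ⊢ _⊑_ (mod (𝓑 a) A ⇒ mod (𝓑 a) (mod (𝓑 a) A))
  ax-IB     : ∀ {a b A} → ⊢ _⊑_ (mod (𝓘 a b) A ⇒ mod (𝓑 a) (mod (𝓘 a b) A))
  ax-IIB    : ∀ {a b A} → ⊢ _⊑_ (mod (𝓘 a b) A ⇒ mod (𝓘 a b) (mod (𝓑 b) A))
  ax-B⊑     : ∀ {a b A} → a ⊑ b → ⊢ _⊑_ (mod (𝓑 a) A ⇒ mod (𝓑 b) A)
  ax-I⊑₁    : ∀ {a b c A} → a ⊑ b → ⊢ _⊑_ (mod (𝓘 a c) A ⇒ mod (𝓘 b c) A)
  ax-I⊑₂    : ∀ {a b c A} → a ⊑ b → ⊢ _⊑_ (mod (𝓘 c a) A ⇒ mod (𝓘 c b) A)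
  ax-□M     : ∀ {M A} → ⊢ _⊑_ (mod □ A ⇒ mod M (mod □ A))
  ax-□T     : ∀ {A} → ⊢ _⊑_ (mod □ A ⇒ A)

Ichain : ∀ {n} → List (Fin n) → Form n → Form n
Ichain (x ∷ y ∷ r) A = mod (𝓘 x y) (Ichain (y ∷ r) A)
Ichain _           A = A

NonEmptyList : ∀ {n} → List (Fin n) → Set
NonEmptyList []      = ⊥
NonEmptyList (_ ∷ _) = ⊤

-- A forwarding network, represented as a finite list of lists of agents
-- (the set S is the set of members of the list).
record ForwardingNetwork {n : ℕ} (S : List (List (Fin n))) : Set where
  field
    nonempty : ∀ {l} → l ∈ S → NonEmptyList l
    distinct : ∀ {l} → l ∈ S → Unique l
    closed₁  : ∀ (a : Fin n) β (c : Fin n) → (a ∷ β ++ [ c ]) ∈ S →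
               ((β ++ [ c ]) ∈ S) × ((a ∷ β) ∈ S)
    closed₂  : ∀ (α : List (Fin n)) a β b γ β′ →
               (α ++ a ∷ β ++ b ∷ γ) ∈ S → (a ∷ β′ ++ [ b ]) ∈ S →
               (α ++ a ∷ β′ ++ b ∷ γ) ∈ S

lastIs : ∀ {n} → Fin n → List (Fin n) → Bool
lastIs b []          = false
lastIs b (y ∷ [])    = ⌊ y ≟ b ⌋
lastIs b (y ∷ z ∷ r) = lastIs b (z ∷ r)

fromTo : ∀ {n} → Fin n → Fin n → List (Fin n) → Bool
fromTo a b []      = false
fromTo a b (x ∷ r) = ⌊ x ≟ a ⌋ ∧ lastIs b r

J : ∀ {n} → List (List (Fin n)) → Fin n → Fin n → Form n → Form n
J S a b A = ⋀ (map (λ l → Ichain l A) (filterᵇ (fromTo a b) S))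

-- Each chain is a composite of normal modalities, hence normal, and normality survives
-- finite conjunctions; this gives (i). Every chain begins with some I_{a←c}, whose
-- introspection axiom I_{a←c}A ⇒ B_a I_{a←c}A yields (ii) once B_a is pulled out of the
-- conjunction. Every chain ends with some I_{c←b}, and I_{c←b}A ⇒ I_{c←b}B_b A propagates
-- outwards by monotonicity of the outer modalities, giving (iii). All three parts hold
-- route by route.
module Submission where

open import Defs
open import Data.Nat using (ℕ)
open import Data.Fin using (Fin; _≟_)
open import Data.Bool using (T)
open import Data.Bool.Properties using (T-∧; T?)
open import Data.List using (List; []; _∷_; _++_; [_]; map; filterᵇ)
open import Data.List.Relation.Unary.All as All using (All; []; _∷_)
open import Data.List.Relation.Unary.All.Properties using (all-filter)
open import Data.Product using (_×_; _,_; ∃-syntax)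
open import Function using (_∘_; Equivalence)
open import Relation.Nullary.Decidable using (toWitness)
open import Relation.Binary.PropositionalEquality using (_≡_; refl; cong)
open import Relation.Binary.Structures using (IsPreorder)

module Derived {n : ℕ} (_⊑_ : Fin n → Fin n → Set) where

  infix 4 ⊢′_
  ⊢′_ : Form n → Set
  ⊢′_ = ⊢ _⊑_

  private
    variable
      I : Set
      A B C X : Form n
      M : Modality n

  ⇒-post : ⊢′ B ⇒ C → ⊢′ (A ⇒ B) ⇒ (A ⇒ C)
  ⇒-post f = mp ax-S (mp ax-K f)

  ⇒-trans : ⊢′ A ⇒ B → ⊢′ B ⇒ C → ⊢′ A ⇒ C
  ⇒-trans f g = mp (⇒-post g) f

  ∧-pair : ⊢′ X ⇒ A → ⊢′ X ⇒ B → ⊢′ X ⇒ A ∧′ B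
  ∧-pair f g = mp (mp ax-S (⇒-trans f ax-∧I)) g

  ∧-curry : ⊢′ A ∧′ B ⇒ C → ⊢′ A ⇒ B ⇒ C
  ∧-curry f = ⇒-trans ax-∧I (⇒-post f)

  ∧-uncurry : ⊢′ A ⇒ B ⇒ C → ⊢′ A ∧′ B ⇒ C
  ∧-uncurry f = mp (mp ax-S (⇒-trans ax-∧E₁ f)) ax-∧E₂

  modus-ponens : ⊢′ A ∧′ (A ⇒ B) ⇒ B
  modus-ponens = ∧-uncurry (∧-curry (mp (mp ax-S ax-∧E₂) ax-∧E₁))

  mod-mono : ⊢′ A ⇒ B → ⊢′ mod M A ⇒ mod M B
  mod-mono f = mp ax-Kₘ (nec f)

  mod-∧ : ⊢′ mod M A ∧′ mod M B ⇒ mod M (A ∧′ B)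
  mod-∧ = ∧-uncurry (⇒-trans (mod-mono ax-∧I) ax-Kₘ)

  ⋀-intro : {f : I → Form n} {L : List I} → All (⊢′_ ∘ f) L → ⊢′ ⋀ (map f L)
  ⋀-intro []       = ax-⊤I
  ⋀-intro (p ∷ ps) = mp (mp ax-∧I p) (⋀-intro ps)

  ⋀-map-mono : {f g : I → Form n} {L : List I} →
               All (λ i → ⊢′ f i ⇒ g i) L → ⊢′ ⋀ (map f L) ⇒ ⋀ (map g L)
  ⋀-map-mono []       = mp ax-K ax-⊤I
  ⋀-map-mono (p ∷ ps) = ∧-pair (⇒-trans ax-∧E₁ p) (⇒-trans ax-∧E₂ (⋀-map-mono ps))

  ⋀-map-zip : {f g h : I → Form n} {L : List I} →
              All (λ i → ⊢′ f i ∧′ g i ⇒ h i) L →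
              ⊢′ ⋀ (map f L) ∧′ ⋀ (map g L) ⇒ ⋀ (map h L)
  ⋀-map-zip []       = mp ax-K ax-⊤I
  ⋀-map-zip (p ∷ ps) =
    ∧-pair (⇒-trans (∧-pair (⇒-trans ax-∧E₁ ax-∧E₁) (⇒-trans ax-∧E₂ ax-∧E₁)) p)
           (⇒-trans (∧-pair (⇒-trans ax-∧E₁ ax-∧E₂) (⇒-trans ax-∧E₂ ax-∧E₂)) (⋀-map-zip ps))

  ⋀-mod : (f : I → Form n) (L : List I) → ⊢′ ⋀ (map (mod M ∘ f) L) ⇒ mod M (⋀ (map f L))
  ⋀-mod f []      = mp ax-K (nec ax-⊤I)
  ⋀-mod f (i ∷ L) = ⇒-trans (∧-pair ax-∧E₁ (⇒-trans ax-∧E₂ (⋀-mod f L))) mod-∧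

  record IsNormal (O : Form n → Form n) : Set where
    field
      distrib       : ⊢′ O A ∧′ O (A ⇒ B) ⇒ O B
      necessitation : ⊢′ A → ⊢′ O A

  open IsNormal

  Ichain-normal : (l : List (Fin n)) → IsNormal (Ichain l)
  Ichain-normal []          = record { distrib = modus-ponens ; necessitation = λ p → p }
  Ichain-normal (x ∷ [])    = record { distrib = modus-ponens ; necessitation = λ p → p }
  Ichain-normal (x ∷ y ∷ r) = record
    { distrib       = ⇒-trans mod-∧ (mod-mono (distrib (Ichain-normal (y ∷ r))))
    ; necessitation = nec ∘ necessitation (Ichain-normal (y ∷ r))
    }

  ⋀-normal : (O : I → Form n → Form n) (L : List I) → All (IsNormal ∘ O) L →
             IsNormal (λ A → ⋀ (map (λ i → O i A) L))
  ⋀-normal O L normal = record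
    { distrib       = ⋀-map-zip (All.map (λ N → distrib N) normal)
    ; necessitation = λ p → ⋀-intro (All.map (λ N → necessitation N p) normal)
    }

  Ichain-B-head : (a : Fin n) (γ : List (Fin n)) (b : Fin n) →
                  ⊢′ Ichain (a ∷ γ ++ [ b ]) A ⇒ mod (𝓑 a) (Ichain (a ∷ γ ++ [ b ]) A)
  Ichain-B-head a []      b = ax-IB
  Ichain-B-head a (c ∷ γ) b = ax-IB

  Ichain-B-last : (a : Fin n) (γ : List (Fin n)) (b : Fin n) →
                  ⊢′ Ichain (a ∷ γ ++ [ b ]) A ⇒ Ichain (a ∷ γ ++ [ b ]) (mod (𝓑 b) A)
  Ichain-B-last a []      b = ax-IIB
  Ichain-B-last a (c ∷ γ) b = mod-mono (Ichain-B-last c γ b)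

module _ {n : ℕ} where

  Route : Fin n → Fin n → List (Fin n) → Set
  Route a b l = ∃[ γ ] l ≡ a ∷ γ ++ [ b ]

  lastIs-sound : ∀ {b} (r : List (Fin n)) → T (lastIs b r) → ∃[ γ ] r ≡ γ ++ [ b ]
  lastIs-sound (y ∷ [])    p = [] , cong [_] (toWitness p)
  lastIs-sound (y ∷ z ∷ r) p with γ , r≡γb ← lastIs-sound (z ∷ r) p = y ∷ γ , cong (y ∷_) r≡γb

  fromTo⇒Route : ∀ {a b} (l : List (Fin n)) → T (fromTo a b l) → Route a b l
  fromTo⇒Route (x ∷ r) p with Equivalence.to T-∧ p
  ... | x≡a , last with refl ← toWitness {a? = x ≟ _} x≡a
                    with γ , refl ← lastIs-sound r last = γ , refl

  filter-fromTo-routes : (a b : Fin n) (S : List (List (Fin n))) →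
                         All (Route a b) (filterᵇ (fromTo a b) S)
  filter-fromTo-routes a b S = All.map (fromTo⇒Route _) (all-filter (T? ∘ fromTo a b) S)

lemma6 : ∀ {n} (_⊑_ : Fin n → Fin n → Set) → IsPreorder _≡_ _⊑_ →
    (S : List (List (Fin n))) → ForwardingNetwork S →
    (a b : Fin n) →
    ((∀ A B → ⊢ _⊑_ (J S a b A ⇒ J S a b (A ⇒ B) ⇒ J S a b B))
    × (∀ A → ⊢ _⊑_ A → ⊢ _⊑_ (J S a b A)))
    × (∀ A → ⊢ _⊑_ (J S a b A ⇒ mod (𝓑 a) (J S a b A)))
    × (∀ A → ⊢ _⊑_ (J S a b A ⇒ J S a b (mod (𝓑 b) A)))
lemma6 _⊑_ _ S _ a b =
    ((λ A B → ∧-curry (IsNormal.distrib J-normal)) , (λ A → IsNormal.necessitation J-normal))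
  , (λ A → ⇒-trans (⋀-map-mono (All.map (λ { (γ , refl) → Ichain-B-head a γ b }) ab-routes))
                   (⋀-mod (λ l → Ichain l A) ab-chains))
  , (λ A → ⋀-map-mono (All.map (λ { (γ , refl) → Ichain-B-last a γ b }) ab-routes))
  where
    open Derived _⊑_
    ab-chains : List (List (Fin _))
    ab-chains = filterᵇ (fromTo a b) S

    ab-routes : All (Route a b) ab-chains
    ab-routes = filter-fromTo-routes a b S

    J-normal : IsNormal (J S a b)
    J-normal = ⋀-normal Ichain ab-chains (All.universal Ichain-normal ab-chains)
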